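{- Let $m>0$. There do not exist $n\ge 0$ and $\lambda$-terms $M_0,\dots,M_n$ such that the following holds: for every sequence of $\lambda$-terms $(Z_j)_{j\ge 0}$ satisfying $Z_jx=x(Z_{j+1}x)$ for all $j\ge0$ (with $x$ a variable not free in $Z_j,Z_{j+1}$), one has $Z_0M_0\cdots M_n=Z_m$.
   Context: Untyped $\lambda$-calculus; $=$ denotes $\beta$-conversion. A weak fixed point combinator (wfpc) $Z$ can equivalently be presented as a sequence of terms $(Z_j)_{j\ge0}$ with $Z=Z_0$ and $Z_jx=x(Z_{j+1}x)$ for $x$ not free in $Z_j,Z_{j+1}$; the statement quantifies over all such sequences. -}

module Defs where

open import Data.Nat using (ℕ; zero; suc; _+_; _∸_; _<ᵇ_; _≡ᵇ_)
open import Data.Bool using (if_then_else_)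
open import Data.Vec using (Vec; foldl)

data Term : Set where
  var : ℕ → Term
  app : Term → Term → Term
  lam : Term → Term

shift : ℕ → ℕ → Term → Term
shift d c (var i) = if i <ᵇ c then var i else var (i + d)
shift d c (app t u) = app (shift d c t) (shift d c u)
shift d c (lam t) = lam (shift d (suc c) t)

weaken : Term → Term
weaken = shift 1 0

-- subst k u t : replace free variable k of t by u (shifted under binders),
-- decrementing free variables above k (the variable k is being removed).
subst : ℕ → Term → Term → Term
subst k u (var i) =
  if i <ᵇ k then var i else (if i ≡ᵇ k then shift k 0 u else var (i ∸ 1))
subst k u (app t s) = app (subst k u t) (subst k u s)
subst k u (lam t) = lam (subst (suc k) u t)

infix 4 _⟶β_ _=β_
data _⟶β_ : Term → Term → Set where
  beta : ∀ {t u} → app (lam t) u ⟶β subst 0 u t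
  appL : ∀ {t t' u} → t ⟶β t' → app t u ⟶β app t' u
  appR : ∀ {t u u'} → u ⟶β u' → app t u ⟶β app t u'
  lamξ : ∀ {t t'} → t ⟶β t' → lam t ⟶β lam t'

data _=β_ : Term → Term → Set where
  step : ∀ {t u} → t ⟶β u → t =β u
  refl : ∀ {t} → t =β t
  sym : ∀ {t u} → t =β u → u =β t
  trans : ∀ {t u v} → t =β u → u =β v → t =β v

apps : ∀ {n} → Term → Vec Term n → Term
apps {n} z ms = foldl (λ _ → Term) app z ms

-- (Z j)ⱼ is a weak fixed point combinator sequence:
-- Z_j x = x (Z_{j+1} x) with x fresh (de Bruijn var 0 after weakening).
IsWfpcSeq : (ℕ → Term) → Set
IsWfpcSeq Z = ∀ j →
  app (weaken (Z j)) (var 0) =β app (var 0) (app (weaken (Z (suc j))) (var 0))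

-- Take the constant sequence Z_j = Y := λx. D x D y, with D := λabc. a (b a b c)
-- and y a variable free in no M_i. Then Y M_0 ⋯ M_n reduces to D M_0 D y M_1 ⋯ M_n, which by Church–Rosser
-- would share a reduct λx. N with Y. In every reduct of D M_0 D y M_1 ⋯ M_n, y
-- occurs only inside residuals of D w D y whose argument w mentions no bound
-- variable, in particular not x; in every reduct of D x D y, y occurs only inside
-- such residuals with w = x, and y does occur, as D x D y is a λI-term. No N
-- satisfies both.
module Submission where

open import Defs
open import Data.Bool using (Bool; true; false)
open import Data.Empty using (⊥; ⊥-elim)
open import Data.Nat
  using (ℕ; zero; suc; _+_; _∸_; _⊔_; _<_; _≤_; _<ᵇ_; _≡ᵇ_; _<?_; z≤n; s≤s)
open import Data.Nat.Properties
open import Data.Product using (Σ; ∃; _×_; _,_; proj₁; proj₂)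
open import Data.Sum using (_⊎_; inj₁; inj₂)
open import Data.Vec using (Vec; []; _∷_; foldl)
open import Data.Vec.Relation.Unary.All as All using (All; []; _∷_)
open import Function using (id)
open import Relation.Binary using (tri<; tri≈; tri>)
open import Relation.Binary.Construct.Closure.ReflexiveTransitive
  using (Star; ε; _◅_; _◅◅_; gmap; fold; kleisliStar)
open import Relation.Binary.PropositionalEquality as ≡ using (_≡_; _≢_; cong; cong₂)
open import Relation.Nullary using (¬_; yes; no)
open import Algebra.Properties.CommutativeSemigroup +-commutativeSemigroup
  using (xy∙z≈xz∙y; xy∙z≈x∙zy; x∙yz≈xz∙y)

<⇒<ᵇ≡true : ∀ {i c} → i < c → (i <ᵇ c) ≡ true
<⇒<ᵇ≡true {zero} {suc c} _ = ≡.refl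
<⇒<ᵇ≡true {suc i} {suc c} (s≤s p) = <⇒<ᵇ≡true p

≥⇒<ᵇ≡false : ∀ {i c} → c ≤ i → (i <ᵇ c) ≡ false
≥⇒<ᵇ≡false {i} {zero} _ = ≡.refl
≥⇒<ᵇ≡false {suc i} {suc c} (s≤s p) = ≥⇒<ᵇ≡false p

≡⇒≡ᵇ≡true : ∀ {i j} → i ≡ j → (i ≡ᵇ j) ≡ true
≡⇒≡ᵇ≡true {zero} ≡.refl = ≡.refl
≡⇒≡ᵇ≡true {suc i} ≡.refl = ≡⇒≡ᵇ≡true {i} ≡.refl

≡ᵇ-refl : ∀ i → (i ≡ᵇ i) ≡ true
≡ᵇ-refl i = ≡⇒≡ᵇ≡true {i} ≡.refl

≢⇒≡ᵇ≡false : ∀ {i j} → i ≢ j → (i ≡ᵇ j) ≡ false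
≢⇒≡ᵇ≡false {zero} {zero} p = ⊥-elim (p ≡.refl)
≢⇒≡ᵇ≡false {zero} {suc j} p = ≡.refl
≢⇒≡ᵇ≡false {suc i} {zero} p = ≡.refl
≢⇒≡ᵇ≡false {suc i} {suc j} p = ≢⇒≡ᵇ≡false (λ q → p (cong suc q))

shift-var-< : ∀ {d c i} → i < c → shift d c (var i) ≡ var i
shift-var-< p rewrite <⇒<ᵇ≡true p = ≡.refl

shift-var-≥ : ∀ {d c i} → c ≤ i → shift d c (var i) ≡ var (i + d)
shift-var-≥ p rewrite ≥⇒<ᵇ≡false p = ≡.refl

subst-var-< : ∀ {k u i} → i < k → subst k u (var i) ≡ var i
subst-var-< p rewrite <⇒<ᵇ≡true p = ≡.refl

subst-var-≡ : ∀ k u → subst k u (var k) ≡ shift k 0 u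
subst-var-≡ k u rewrite ≥⇒<ᵇ≡false (≤-refl {k}) | ≡ᵇ-refl k = ≡.refl

subst-var-> : ∀ {k u i} → k ≤ i → subst k u (var (suc i)) ≡ var i
subst-var-> p
  rewrite ≥⇒<ᵇ≡false (m≤n⇒m≤1+n p) | ≢⇒≡ᵇ≡false (>⇒≢ (s≤s p)) = ≡.refl

shift-zero : ∀ c u → shift 0 c u ≡ u
shift-zero c (var i) with i <? c
... | yes p = shift-var-< p
... | no ¬p = ≡.trans (shift-var-≥ (≮⇒≥ ¬p)) (cong var (+-identityʳ i))
shift-zero c (app t u) = cong₂ app (shift-zero c t) (shift-zero c u)
shift-zero c (lam t) = cong lam (shift-zero (suc c) t)

shift-shift-commute : ∀ e c k d u → e ≤ c → shift d (k + c) (shift k e u) ≡ shift k e (shift d c u)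
shift-shift-commute e c k d (var i) e≤c with i <? e | i <? c
... | yes i<e | _
  rewrite <⇒<ᵇ≡true (<-≤-trans i<e e≤c) | <⇒<ᵇ≡true i<e
        | <⇒<ᵇ≡true (<-≤-trans i<e (≤-trans e≤c (m≤n+m c k))) = ≡.refl
... | no i≮e | yes i<c
  rewrite <⇒<ᵇ≡true i<c | ≥⇒<ᵇ≡false (≮⇒≥ i≮e)
        | <⇒<ᵇ≡true (≡.subst (i + k <_) (+-comm c k) (+-monoˡ-< k i<c)) = ≡.refl
... | no i≮e | no i≮c
  rewrite ≥⇒<ᵇ≡false (≮⇒≥ i≮c) | ≥⇒<ᵇ≡false (≮⇒≥ i≮e)
        | ≥⇒<ᵇ≡false (≡.subst (_≤ i + k) (+-comm c k) (+-monoˡ-≤ k (≮⇒≥ i≮c)))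
        | ≥⇒<ᵇ≡false (≤-trans (≮⇒≥ i≮e) (m≤m+n i d)) = cong var (xy∙z≈xz∙y i k d)
shift-shift-commute e c k d (app t u) e≤c =
  cong₂ app (shift-shift-commute e c k d t e≤c) (shift-shift-commute e c k d u e≤c)
shift-shift-commute e c k d (lam t) e≤c =
  cong lam (≡.trans (cong (λ c′ → shift d c′ (shift k (suc e) t)) (≡.sym (+-suc k c)))
                    (shift-shift-commute (suc e) (suc c) k d t (s≤s e≤c)))

shift-shift-merge : ∀ e c j k u → c ≤ k → shift j (e + c) (shift k e u) ≡ shift (j + k) e u
shift-shift-merge e c j k (var i) c≤k with i <? e
... | yes i<e rewrite <⇒<ᵇ≡true i<e | <⇒<ᵇ≡true (<-≤-trans i<e (m≤m+n e c)) = ≡.refl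
... | no i≮e
  rewrite ≥⇒<ᵇ≡false (≮⇒≥ i≮e) | ≥⇒<ᵇ≡false (+-mono-≤ (≮⇒≥ i≮e) c≤k) =
  cong var (xy∙z≈x∙zy i k j)
shift-shift-merge e c j k (app t u) c≤k =
  cong₂ app (shift-shift-merge e c j k t c≤k) (shift-shift-merge e c j k u c≤k)
shift-shift-merge e c j k (lam t) c≤k = cong lam (shift-shift-merge (suc e) c j k t c≤k)

subst-shift-commute : ∀ c k j u v → c ≤ k → subst (j + k) u (shift j c v) ≡ shift j c (subst k u v)
subst-shift-commute c k j u (var i) c≤k with i <? c | <-cmp i k
... | yes i<c | _
  rewrite <⇒<ᵇ≡true (<-≤-trans i<c c≤k) | <⇒<ᵇ≡true i<c
        | <⇒<ᵇ≡true (<-≤-trans i<c (≤-trans c≤k (m≤n+m k j))) = ≡.refl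
... | no i≮c | tri< i<k _ _
  rewrite <⇒<ᵇ≡true i<k | ≥⇒<ᵇ≡false (≮⇒≥ i≮c)
        | <⇒<ᵇ≡true (≡.subst (i + j <_) (+-comm k j) (+-monoˡ-< j i<k)) = ≡.refl
... | no i≮c | tri≈ _ ≡.refl _
  rewrite ≥⇒<ᵇ≡false (≤-refl {i}) | ≡ᵇ-refl i | ≥⇒<ᵇ≡false (≮⇒≥ i≮c)
        | ≥⇒<ᵇ≡false (≤-reflexive (+-comm j i)) | ≡⇒≡ᵇ≡true (+-comm i j) =
  ≡.sym (shift-shift-merge 0 c j i u c≤k)
subst-shift-commute c k j u (var (suc i)) c≤k | no i≮c | tri> _ _ (s≤s k≤i)
  rewrite ≥⇒<ᵇ≡false (m≤n⇒m≤1+n k≤i) | ≢⇒≡ᵇ≡false (>⇒≢ (s≤s k≤i))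
        | ≥⇒<ᵇ≡false (≤-trans c≤k k≤i) | ≥⇒<ᵇ≡false (≮⇒≥ i≮c)
        | ≥⇒<ᵇ≡false (m≤n⇒m≤1+n (≡.subst (_≤ i + j) (+-comm k j) (+-monoˡ-≤ j k≤i)))
        | ≢⇒≡ᵇ≡false (>⇒≢ (s≤s (≡.subst (_≤ i + j) (+-comm k j) (+-monoˡ-≤ j k≤i)))) = ≡.refl
subst-shift-commute c k j u (app t v) c≤k =
  cong₂ app (subst-shift-commute c k j u t c≤k) (subst-shift-commute c k j u v c≤k)
subst-shift-commute c k j u (lam t) c≤k =
  cong lam (≡.trans (cong (λ k′ → subst k′ u (shift j (suc c) t)) (≡.sym (+-suc j k)))
                    (subst-shift-commute (suc c) (suc k) j u t (s≤s c≤k)))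

subst-shift-absorb : ∀ e j m w u → e ≤ j → j ≤ e + m →
  subst j w (shift (suc m) e u) ≡ shift m e u
subst-shift-absorb e j m w (var i) e≤j j≤e+m with i <? e
... | yes i<e rewrite <⇒<ᵇ≡true i<e | <⇒<ᵇ≡true (<-≤-trans i<e e≤j) = ≡.refl
... | no i≮e
  rewrite ≥⇒<ᵇ≡false (≮⇒≥ i≮e) | +-suc i m
        | ≥⇒<ᵇ≡false (m≤n⇒m≤1+n (≤-trans j≤e+m (+-monoˡ-≤ m (≮⇒≥ i≮e))))
        | ≢⇒≡ᵇ≡false (>⇒≢ (s≤s (≤-trans j≤e+m (+-monoˡ-≤ m (≮⇒≥ i≮e))))) = ≡.refl
subst-shift-absorb e j m w (app t u) e≤j j≤e+m =
  cong₂ app (subst-shift-absorb e j m w t e≤j j≤e+m) (subst-shift-absorb e j m w u e≤j j≤e+m)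
subst-shift-absorb e j m w (lam t) e≤j j≤e+m =
  cong lam (subst-shift-absorb (suc e) (suc j) m w t (s≤s e≤j) (s≤s j≤e+m))

subst-subst-commute : ∀ j k u v t →
  subst (j + k) u (subst j v t) ≡ subst j (subst k u v) (subst (suc (j + k)) u t)
subst-subst-commute j k u v (var i) with <-cmp i j
... | tri< i<j _ _
  rewrite <⇒<ᵇ≡true (<-≤-trans i<j (m≤n⇒m≤1+n (m≤m+n j k))) | <⇒<ᵇ≡true i<j
        | <⇒<ᵇ≡true (<-≤-trans i<j (m≤m+n j k)) = ≡.refl
... | tri≈ _ ≡.refl _
  rewrite <⇒<ᵇ≡true (s≤s (m≤m+n i k)) | ≥⇒<ᵇ≡false (≤-refl {i}) | ≡ᵇ-refl i =
  subst-shift-commute 0 k i u v z≤n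
subst-subst-commute j k u v (var (suc i)) | tri> _ _ (s≤s j≤i)
  rewrite ≥⇒<ᵇ≡false (m≤n⇒m≤1+n j≤i) | ≢⇒≡ᵇ≡false (>⇒≢ (s≤s j≤i))
  with <-cmp i (j + k)
... | tri< i<j+k _ _
  rewrite <⇒<ᵇ≡true i<j+k | ≥⇒<ᵇ≡false (m≤n⇒m≤1+n j≤i)
        | ≢⇒≡ᵇ≡false (>⇒≢ (s≤s j≤i)) = ≡.refl
... | tri≈ _ ≡.refl _ rewrite ≥⇒<ᵇ≡false (≤-refl {j + k}) | ≡ᵇ-refl (j + k) =
  ≡.sym (subst-shift-absorb 0 j (j + k) (subst k u v) u z≤n (m≤m+n j k))
subst-subst-commute j k u v (var (suc (suc i))) | tri> _ _ (s≤s j≤i) | tri> _ _ (s≤s j+k≤i)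
  rewrite ≥⇒<ᵇ≡false (m≤n⇒m≤1+n j+k≤i) | ≢⇒≡ᵇ≡false (>⇒≢ (s≤s j+k≤i))
        | ≥⇒<ᵇ≡false (m≤n⇒m≤1+n (≤-trans (m≤m+n j k) j+k≤i))
        | ≢⇒≡ᵇ≡false (>⇒≢ (s≤s (≤-trans (m≤m+n j k) j+k≤i))) = ≡.refl
subst-subst-commute j k u v (app t s) =
  cong₂ app (subst-subst-commute j k u v t) (subst-subst-commute j k u v s)
subst-subst-commute j k u v (lam t) = cong lam (subst-subst-commute (suc j) k u v t)

shift-subst-commute : ∀ k c d u t →
  shift d (k + c) (subst k u t) ≡ subst k (shift d c u) (shift d (suc (k + c)) t)
shift-subst-commute k c d u (var i) with <-cmp i k
... | tri< i<k _ _
  rewrite <⇒<ᵇ≡true (<-≤-trans i<k (m≤n⇒m≤1+n (m≤m+n k c))) | <⇒<ᵇ≡true i<k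
        | <⇒<ᵇ≡true (<-≤-trans i<k (m≤m+n k c)) = ≡.refl
... | tri≈ _ ≡.refl _
  rewrite <⇒<ᵇ≡true (s≤s (m≤m+n i c)) | ≥⇒<ᵇ≡false (≤-refl {i}) | ≡ᵇ-refl i =
  shift-shift-commute 0 c i d u z≤n
shift-subst-commute k c d u (var (suc i)) | tri> _ _ (s≤s k≤i)
  rewrite ≥⇒<ᵇ≡false (m≤n⇒m≤1+n k≤i) | ≢⇒≡ᵇ≡false (>⇒≢ (s≤s k≤i))
  with i <? k + c
... | yes i<k+c
  rewrite <⇒<ᵇ≡true i<k+c | ≥⇒<ᵇ≡false (m≤n⇒m≤1+n k≤i)
        | ≢⇒≡ᵇ≡false (>⇒≢ (s≤s k≤i)) = ≡.refl
... | no i≮k+c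
  rewrite ≥⇒<ᵇ≡false (≮⇒≥ i≮k+c) | ≥⇒<ᵇ≡false (m≤n⇒m≤1+n (≤-trans k≤i (m≤m+n i d)))
        | ≢⇒≡ᵇ≡false (>⇒≢ (s≤s (≤-trans k≤i (m≤m+n i d)))) = ≡.refl
shift-subst-commute k c d u (app t s) =
  cong₂ app (shift-subst-commute k c d u t) (shift-subst-commute k c d u s)
shift-subst-commute k c d u (lam t) = cong lam (shift-subst-commute (suc k) c d u t)

-- Church–Rosser, via Takahashi's complete developments

infix 4 _↠_ _⇛_ _⇛*_

_↠_ : Term → Term → Set
_↠_ = Star _⟶β_

↠-appˡ : ∀ {t t′ u} → t ↠ t′ → app t u ↠ app t′ u
↠-appˡ {u = u} = gmap (λ t → app t u) appL

↠-appʳ : ∀ {t u u′} → u ↠ u′ → app t u ↠ app t u′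
↠-appʳ {t} = gmap (app t) appR

↠-lam : ∀ {t t′} → t ↠ t′ → lam t ↠ lam t′
↠-lam = gmap lam lamξ

↠⇒=β : ∀ {t u} → t ↠ u → t =β u
↠⇒=β = fold _=β_ (λ s e → trans (step s) e) refl

data _⇛_ : Term → Term → Set where
  pvar : ∀ {i} → var i ⇛ var i
  plam : ∀ {t t′} → t ⇛ t′ → lam t ⇛ lam t′
  papp : ∀ {t t′ u u′} → t ⇛ t′ → u ⇛ u′ → app t u ⇛ app t′ u′
  pbeta : ∀ {t t′ u u′} → t ⇛ t′ → u ⇛ u′ → app (lam t) u ⇛ subst 0 u′ t′

_⇛*_ : Term → Term → Set
_⇛*_ = Star _⇛_

⇛-refl : ∀ t → t ⇛ t
⇛-refl (var i) = pvar
⇛-refl (app t u) = papp (⇛-refl t) (⇛-refl u)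
⇛-refl (lam t) = plam (⇛-refl t)

⟶β⇒⇛ : ∀ {t t′} → t ⟶β t′ → t ⇛ t′
⟶β⇒⇛ (beta {t} {u}) = pbeta (⇛-refl t) (⇛-refl u)
⟶β⇒⇛ (appL {u = u} s) = papp (⟶β⇒⇛ s) (⇛-refl u)
⟶β⇒⇛ (appR {t} s) = papp (⇛-refl t) (⟶β⇒⇛ s)
⟶β⇒⇛ (lamξ s) = plam (⟶β⇒⇛ s)

⇛⇒↠ : ∀ {t t′} → t ⇛ t′ → t ↠ t′
⇛⇒↠ pvar = ε
⇛⇒↠ (plam p) = ↠-lam (⇛⇒↠ p)
⇛⇒↠ (papp p q) = ↠-appˡ (⇛⇒↠ p) ◅◅ ↠-appʳ (⇛⇒↠ q)
⇛⇒↠ (pbeta p q) = ↠-appˡ (↠-lam (⇛⇒↠ p)) ◅◅ ↠-appʳ (⇛⇒↠ q) ◅◅ beta ◅ ε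

⇛*⇒↠ : ∀ {t t′} → t ⇛* t′ → t ↠ t′
⇛*⇒↠ = kleisliStar id ⇛⇒↠

⇛-shift : ∀ {t t′} d c → t ⇛ t′ → shift d c t ⇛ shift d c t′
⇛-shift d c (pvar {i}) = ⇛-refl (shift d c (var i))
⇛-shift d c (plam p) = plam (⇛-shift d (suc c) p)
⇛-shift d c (papp p q) = papp (⇛-shift d c p) (⇛-shift d c q)
⇛-shift d c (pbeta {t} {t′} {u} {u′} p q) =
  ≡.subst (shift d c (app (lam t) u) ⇛_) (≡.sym (shift-subst-commute 0 c d u′ t′))
    (pbeta (⇛-shift d (suc c) p) (⇛-shift d c q))

⇛-subst : ∀ {t t′ u u′} k → t ⇛ t′ → u ⇛ u′ → subst k u t ⇛ subst k u′ t′
⇛-subst k (pvar {i}) q with i <ᵇ k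
... | true = pvar
... | false with i ≡ᵇ k
...   | true = ⇛-shift k 0 q
...   | false = pvar
⇛-subst k (plam p) q = plam (⇛-subst (suc k) p q)
⇛-subst k (papp p p₁) q = papp (⇛-subst k p q) (⇛-subst k p₁ q)
⇛-subst {u = u} {u′} k (pbeta {t} {t′} {v} {v′} p p₁) q =
  ≡.subst (subst k u (app (lam t) v) ⇛_) (≡.sym (subst-subst-commute 0 k u′ v′ t′))
    (pbeta (⇛-subst (suc k) p q) (⇛-subst k p₁ q))

develop : Term → Term
developApp : Term → Term → Term
develop (var i) = var i
develop (lam t) = lam (develop t)
develop (app t u) = developApp t u
developApp (lam t) u = subst 0 (develop u) (develop t)
developApp (var i) u = app (var i) (develop u)
developApp (app a b) u = app (developApp a b) (develop u)

⇛-develop : ∀ {t t′} → t ⇛ t′ → t′ ⇛ develop t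
⇛-develop pvar = pvar
⇛-develop (plam p) = plam (⇛-develop p)
⇛-develop (papp {var i} pvar q) = papp pvar (⇛-develop q)
⇛-develop (papp {app a b} p q) = papp (⇛-develop p) (⇛-develop q)
⇛-develop (papp {lam a} (plam p) q) = pbeta (⇛-develop p) (⇛-develop q)
⇛-develop (pbeta p q) = ⇛-subst 0 (⇛-develop p) (⇛-develop q)

⇛-strip : ∀ {t t₁ t₂} → t ⇛ t₁ → t ⇛* t₂ → ∃ λ s → t₁ ⇛* s × t₂ ⇛ s
⇛-strip p ε = _ , ε , p
⇛-strip p (q ◅ qs) =
  let s , r , r′ = ⇛-strip (⇛-develop q) qs in s , ⇛-develop p ◅ r , r′

⇛*-confluent : ∀ {t t₁ t₂} → t ⇛* t₁ → t ⇛* t₂ → ∃ λ s → t₁ ⇛* s × t₂ ⇛* s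
⇛*-confluent ε q = _ , q , ε
⇛*-confluent (p ◅ ps) q =
  let s , r , r′ = ⇛-strip p q
      s′ , a , b = ⇛*-confluent ps r
  in s′ , a , r′ ◅ b

=β⇒⇛*-common : ∀ {t u} → t =β u → ∃ λ s → t ⇛* s × u ⇛* s
=β⇒⇛*-common (step s) = _ , ⟶β⇒⇛ s ◅ ε , ε
=β⇒⇛*-common refl = _ , ε , ε
=β⇒⇛*-common (sym e) = let s , a , b = =β⇒⇛*-common e in s , b , a
=β⇒⇛*-common (trans e f) =
  let _ , a₁ , b₁ = =β⇒⇛*-common e
      _ , a₂ , b₂ = =β⇒⇛*-common f
      s , c , d = ⇛*-confluent b₁ a₂
  in s , a₁ ◅◅ c , b₂ ◅◅ d

church-rosser : ∀ {t u} → t =β u → ∃ λ s → t ↠ s × u ↠ s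
church-rosser e = let s , a , b = =β⇒⇛*-common e in s , ⇛*⇒↠ a , ⇛*⇒↠ b

↠-invariant : ∀ {P : Term → Set} → (∀ {t t′} → P t → t ⟶β t′ → P t′) →
  ∀ {t t′} → P t → t ↠ t′ → P t′
↠-invariant step-inv p ε = p
↠-invariant step-inv p (s ◅ ss) = ↠-invariant step-inv (step-inv p s) ss

lam-↠⁻ : ∀ {b N} → lam b ↠ N → ∃ λ b′ → N ≡ lam b′ × b ↠ b′
lam-↠⁻ ε = _ , ≡.refl , ε
lam-↠⁻ (lamξ s ◅ ss) = let b′ , e , r = lam-↠⁻ ss in b′ , e , s ◅ r

infix 4 _∈FV_

data _∈FV_ : ℕ → Term → Set where
  fv-var : ∀ {i} → i ∈FV var i
  fv-appˡ : ∀ {i t u} → i ∈FV t → i ∈FV app t u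
  fv-appʳ : ∀ {i t u} → i ∈FV u → i ∈FV app t u
  fv-lam : ∀ {i t} → suc i ∈FV t → i ∈FV lam t

∈FV-shift-< : ∀ {i u} d c → i ∈FV u → i < c → i ∈FV (shift d c u)
∈FV-shift-< d c fv-var p rewrite shift-var-< {d} p = fv-var
∈FV-shift-< d c (fv-appˡ f) p = fv-appˡ (∈FV-shift-< d c f p)
∈FV-shift-< d c (fv-appʳ f) p = fv-appʳ (∈FV-shift-< d c f p)
∈FV-shift-< d c (fv-lam f) p = fv-lam (∈FV-shift-< d (suc c) f (s≤s p))

∈FV-shift-≥ : ∀ {i u} d c → i ∈FV u → c ≤ i → i + d ∈FV shift d c u
∈FV-shift-≥ d c fv-var p rewrite shift-var-≥ {d} p = fv-var
∈FV-shift-≥ d c (fv-appˡ f) p = fv-appˡ (∈FV-shift-≥ d c f p)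
∈FV-shift-≥ d c (fv-appʳ f) p = fv-appʳ (∈FV-shift-≥ d c f p)
∈FV-shift-≥ d c (fv-lam f) p = fv-lam (∈FV-shift-≥ d (suc c) f (s≤s p))

∈FV-subst-< : ∀ {i t} k u → i ∈FV t → i < k → i ∈FV (subst k u t)
∈FV-subst-< k u fv-var p rewrite subst-var-< {u = u} p = fv-var
∈FV-subst-< k u (fv-appˡ f) p = fv-appˡ (∈FV-subst-< k u f p)
∈FV-subst-< k u (fv-appʳ f) p = fv-appʳ (∈FV-subst-< k u f p)
∈FV-subst-< k u (fv-lam f) p = fv-lam (∈FV-subst-< (suc k) u f (s≤s p))

∈FV-subst-> : ∀ {i t} k u → suc i ∈FV t → k ≤ i → i ∈FV (subst k u t)
∈FV-subst-> k u (fv-var {suc i}) p rewrite subst-var-> {k} {u} {i} p = fv-var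
∈FV-subst-> k u (fv-appˡ f) p = fv-appˡ (∈FV-subst-> k u f p)
∈FV-subst-> k u (fv-appʳ f) p = fv-appʳ (∈FV-subst-> k u f p)
∈FV-subst-> k u (fv-lam f) p = fv-lam (∈FV-subst-> (suc k) u f (s≤s p))

∈FV-subst-≡ : ∀ {i t} k u → k ∈FV t → i ∈FV u → i + k ∈FV subst k u t
∈FV-subst-≡ k u fv-var g rewrite subst-var-≡ k u = ∈FV-shift-≥ k 0 g z≤n
∈FV-subst-≡ k u (fv-appˡ f) g = fv-appˡ (∈FV-subst-≡ k u f g)
∈FV-subst-≡ k u (fv-appʳ f) g = fv-appʳ (∈FV-subst-≡ k u f g)
∈FV-subst-≡ {i} k u (fv-lam {t = t} f) g =
  fv-lam (≡.subst (_∈FV subst (suc k) u t) (+-suc i k) (∈FV-subst-≡ (suc k) u f g))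

∈FV-shift⁻ : ∀ {i} d c u → i ∈FV shift d c u →
  (i < c × i ∈FV u) ⊎ ∃ λ i₀ → c ≤ i₀ × i ≡ i₀ + d × i₀ ∈FV u
∈FV-shift⁻ d c (var j) f with j <? c
... | yes p rewrite shift-var-< {d} {c} {j} p with f
...   | fv-var = inj₁ (p , fv-var)
∈FV-shift⁻ d c (var j) f | no ¬p rewrite shift-var-≥ {d} {c} {j} (≮⇒≥ ¬p) with f
...   | fv-var = inj₂ (j , ≮⇒≥ ¬p , ≡.refl , fv-var)
∈FV-shift⁻ d c (app u u₁) (fv-appˡ f) with ∈FV-shift⁻ d c u f
... | inj₁ (p , g) = inj₁ (p , fv-appˡ g)
... | inj₂ (i₀ , p , e , g) = inj₂ (i₀ , p , e , fv-appˡ g)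
∈FV-shift⁻ d c (app u u₁) (fv-appʳ f) with ∈FV-shift⁻ d c u₁ f
... | inj₁ (p , g) = inj₁ (p , fv-appʳ g)
... | inj₂ (i₀ , p , e , g) = inj₂ (i₀ , p , e , fv-appʳ g)
∈FV-shift⁻ d c (lam u) (fv-lam f) with ∈FV-shift⁻ d (suc c) u f
... | inj₁ (s≤s p , g) = inj₁ (p , fv-lam g)
... | inj₂ (suc i₀ , s≤s p , e , g) = inj₂ (i₀ , p , suc-injective e , fv-lam g)

∈FV-subst⁻ : ∀ {i} k u t → i ∈FV (subst k u t) →
  (i < k × i ∈FV t) ⊎ ((k ≤ i × suc i ∈FV t) ⊎ (k ∈FV t × ∃ λ i₀ → i ≡ i₀ + k × i₀ ∈FV u))
∈FV-subst⁻ k u (var j) f with <-cmp j k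
... | tri< p _ _ rewrite subst-var-< {k} {u} {j} p with f
...   | fv-var = inj₁ (p , fv-var)
∈FV-subst⁻ k u (var j) f | tri≈ _ ≡.refl _ rewrite subst-var-≡ j u with ∈FV-shift⁻ j 0 u f
... | inj₂ (i₀ , _ , e , g) = inj₂ (inj₂ (fv-var , i₀ , e , g))
∈FV-subst⁻ k u (var (suc j)) f | tri> _ _ (s≤s p) rewrite subst-var-> {k} {u} {j} p with f
...   | fv-var = inj₂ (inj₁ (p , fv-var))
∈FV-subst⁻ k u (app t t₁) (fv-appˡ f) with ∈FV-subst⁻ k u t f
... | inj₁ (p , g) = inj₁ (p , fv-appˡ g)
... | inj₂ (inj₁ (p , g)) = inj₂ (inj₁ (p , fv-appˡ g))
... | inj₂ (inj₂ (g , r)) = inj₂ (inj₂ (fv-appˡ g , r))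
∈FV-subst⁻ k u (app t t₁) (fv-appʳ f) with ∈FV-subst⁻ k u t₁ f
... | inj₁ (p , g) = inj₁ (p , fv-appʳ g)
... | inj₂ (inj₁ (p , g)) = inj₂ (inj₁ (p , fv-appʳ g))
... | inj₂ (inj₂ (g , r)) = inj₂ (inj₂ (fv-appʳ g , r))
∈FV-subst⁻ k u (lam t) (fv-lam f) with ∈FV-subst⁻ (suc k) u t f
... | inj₁ (s≤s p , g) = inj₁ (p , fv-lam g)
... | inj₂ (inj₁ (s≤s p , g)) = inj₂ (inj₁ (p , fv-lam g))
... | inj₂ (inj₂ (g , i₀ , e , h)) =
  inj₂ (inj₂ (fv-lam g , i₀ , suc-injective (≡.trans e (+-suc i₀ k)) , h))

∈FV-⟶β⁻ : ∀ {i t t′} → t ⟶β t′ → i ∈FV t′ → i ∈FV t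
∈FV-⟶β⁻ (beta {b} {u}) f with ∈FV-subst⁻ 0 u b f
... | inj₂ (inj₁ (_ , g)) = fv-appˡ (fv-lam g)
... | inj₂ (inj₂ (_ , i₀ , e , g)) rewrite ≡.trans e (+-identityʳ i₀) = fv-appʳ g
∈FV-⟶β⁻ (appL s) (fv-appˡ f) = fv-appˡ (∈FV-⟶β⁻ s f)
∈FV-⟶β⁻ (appL s) (fv-appʳ f) = fv-appʳ f
∈FV-⟶β⁻ (appR s) (fv-appˡ f) = fv-appˡ f
∈FV-⟶β⁻ (appR s) (fv-appʳ f) = fv-appʳ (∈FV-⟶β⁻ s f)
∈FV-⟶β⁻ (lamξ s) (fv-lam f) = fv-lam (∈FV-⟶β⁻ s f)

data LambdaI : Term → Set where
  li-var : ∀ {i} → LambdaI (var i)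
  li-app : ∀ {t u} → LambdaI t → LambdaI u → LambdaI (app t u)
  li-lam : ∀ {t} → 0 ∈FV t → LambdaI t → LambdaI (lam t)

LambdaI-shift : ∀ {t} d c → LambdaI t → LambdaI (shift d c t)
LambdaI-shift d c (li-var {i}) with i <ᵇ c
... | true = li-var
... | false = li-var
LambdaI-shift d c (li-app l l₁) = li-app (LambdaI-shift d c l) (LambdaI-shift d c l₁)
LambdaI-shift d c (li-lam f l) =
  li-lam (∈FV-shift-< d (suc c) f (s≤s z≤n)) (LambdaI-shift d (suc c) l)

LambdaI-subst : ∀ {t u} k → LambdaI t → LambdaI u → LambdaI (subst k u t)
LambdaI-subst k (li-var {i}) lu with i <ᵇ k
... | true = li-var
... | false with i ≡ᵇ k
...   | true = LambdaI-shift k 0 lu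
...   | false = li-var
LambdaI-subst k (li-app l l′) lu = li-app (LambdaI-subst k l lu) (LambdaI-subst k l′ lu)
LambdaI-subst {u = u} k (li-lam f l) lu =
  li-lam (∈FV-subst-< (suc k) u f (s≤s z≤n)) (LambdaI-subst (suc k) l lu)

LambdaI-⟶β-∈FV : ∀ {i t t′} → LambdaI t → t ⟶β t′ → i ∈FV t → i ∈FV t′
LambdaI-⟶β-∈FV (li-app _ _) (beta {u = u}) (fv-appˡ (fv-lam f)) = ∈FV-subst-> 0 u f z≤n
LambdaI-⟶β-∈FV {i} (li-app (li-lam f₀ _) _) (beta {b} {u}) (fv-appʳ g) =
  ≡.subst (λ z → z ∈FV (subst 0 u b)) (+-identityʳ i) (∈FV-subst-≡ 0 u f₀ g)
LambdaI-⟶β-∈FV (li-app l l₁) (appL s) (fv-appˡ f) = fv-appˡ (LambdaI-⟶β-∈FV l s f)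
LambdaI-⟶β-∈FV (li-app l l₁) (appL s) (fv-appʳ f) = fv-appʳ f
LambdaI-⟶β-∈FV (li-app l l₁) (appR s) (fv-appˡ f) = fv-appˡ f
LambdaI-⟶β-∈FV (li-app l l₁) (appR s) (fv-appʳ f) = fv-appʳ (LambdaI-⟶β-∈FV l₁ s f)
LambdaI-⟶β-∈FV (li-lam _ l) (lamξ s) (fv-lam f) = fv-lam (LambdaI-⟶β-∈FV l s f)

LambdaI-⟶β : ∀ {t t′} → LambdaI t → t ⟶β t′ → LambdaI t′
LambdaI-⟶β (li-app (li-lam _ lb) lu) beta = LambdaI-subst 0 lb lu
LambdaI-⟶β (li-app l l₁) (appL s) = li-app (LambdaI-⟶β l s) l₁
LambdaI-⟶β (li-app l l₁) (appR s) = li-app l (LambdaI-⟶β l₁ s)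
LambdaI-⟶β (li-lam f l) (lamξ s) = li-lam (LambdaI-⟶β-∈FV l s f) (LambdaI-⟶β l s)

fvBound : Term → ℕ
fvBound (var i) = suc i
fvBound (app a b) = fvBound a ⊔ fvBound b
fvBound (lam b) = fvBound b ∸ 1

∈FV⇒<fvBound : ∀ {i t} → i ∈FV t → i < fvBound t
∈FV⇒<fvBound fv-var = ≤-refl
∈FV⇒<fvBound {t = app a b} (fv-appˡ f) =
  <-≤-trans (∈FV⇒<fvBound f) (m≤m⊔n (fvBound a) (fvBound b))
∈FV⇒<fvBound {t = app a b} (fv-appʳ f) =
  <-≤-trans (∈FV⇒<fvBound f) (m≤n⊔m (fvBound a) (fvBound b))
∈FV⇒<fvBound (fv-lam f) = ∸-monoˡ-≤ 1 (∈FV⇒<fvBound f)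

-- Residuals of D w D y

D : Term
D = lam (lam (lam (app (var 2) (app (app (app (var 1) (var 2)) (var 1)) (var 0)))))

D-normal : ∀ {t} → ¬ (D ⟶β t)
D-normal (lamξ (lamξ (lamξ (appL ()))))
D-normal (lamξ (lamξ (lamξ (appR (appL (appL (appL ())))))))
D-normal (lamξ (lamξ (lamξ (appR (appL (appL (appR ())))))))
D-normal (lamξ (lamξ (lamξ (appR (appL (appR ()))))))
D-normal (lamξ (lamξ (lamξ (appR (appR ())))))

LambdaI-D : LambdaI D
LambdaI-D =
  li-lam (fv-lam (fv-lam (fv-appˡ fv-var)))
    (li-lam (fv-lam (fv-appʳ (fv-appˡ (fv-appˡ (fv-appˡ fv-var)))))
      (li-lam (fv-appʳ (fv-appʳ fv-var))
        (li-app li-var (li-app (li-app (li-app li-var li-var) li-var) li-var))))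

infixr 5 _◃_

_◃_ : Bool → (ℕ → Bool) → ℕ → Bool
(b ◃ f) zero = b
(b ◃ f) (suc i) = f i

shiftIndex : ℕ → ℕ → ℕ → ℕ
shiftIndex k c i with i <? c
... | yes _ = i
... | no _ = i + k

shift-var : ∀ k c i → shift k c (var i) ≡ var (shiftIndex k c i)
shift-var k c i with i <? c
... | yes p = shift-var-< p
... | no ¬p = shift-var-≥ (≮⇒≥ ¬p)

record Shifted (k c : ℕ) (f f′ : ℕ → Bool) : Set where
  field
    shifted-below : ∀ i → i < c → f′ i ≡ f i
    shifted-above : ∀ i → c ≤ i → f′ (i + k) ≡ f i
open Shifted

Shifted-index : ∀ {k c f f′} → Shifted k c f f′ → ∀ i → f′ (shiftIndex k c i) ≡ f i
Shifted-index {k} {c} r i with i <? c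
... | yes p = shifted-below r i p
... | no ¬p = shifted-above r i (≮⇒≥ ¬p)

Shifted-◃ : ∀ {k c f f′} b → Shifted k c f f′ → Shifted k (suc c) (b ◃ f) (b ◃ f′)
shifted-below (Shifted-◃ b r) zero _ = ≡.refl
shifted-below (Shifted-◃ b r) (suc i) (s≤s p) = shifted-below r i p
shifted-above (Shifted-◃ b r) (suc i) (s≤s p) = shifted-above r i p

Shifted-2 : ∀ b c f → Shifted 2 0 f (b ◃ c ◃ f)
shifted-below (Shifted-2 b c f) i ()
shifted-above (Shifted-2 b c f) i _ rewrite +-comm i 2 = ≡.refl

-- Marks f before, f′ after substituting for variable j a term whose own
-- variables carry the marks f₀.
record Substituted (j : ℕ) (f f′ f₀ : ℕ → Bool) : Set where
  field
    substituted-below : ∀ i → i < j → f i ≡ f′ i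
    substituted-above : ∀ i → j ≤ i → f (suc i) ≡ f′ i
    substituted-base : ∀ i → f′ (i + j) ≡ f₀ i
open Substituted

Substituted-◃ : ∀ {j f f′ f₀} b → Substituted j f f′ f₀ →
  Substituted (suc j) (b ◃ f) (b ◃ f′) f₀
substituted-below (Substituted-◃ b r) zero _ = ≡.refl
substituted-below (Substituted-◃ b r) (suc i) (s≤s p) = substituted-below r i p
substituted-above (Substituted-◃ b r) (suc i) (s≤s p) = substituted-above r i p
substituted-base (Substituted-◃ {j} b r) i rewrite +-suc i j = substituted-base r i

Substituted-0 : ∀ b f → Substituted 0 (b ◃ f) f f
substituted-below (Substituted-0 b f) i ()
substituted-above (Substituted-0 b f) i _ = ≡.refl
substituted-base (Substituted-0 b f) i = cong f (+-identityʳ i)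

Substituted-1 : ∀ b c f → Substituted 1 (b ◃ c ◃ f) (b ◃ f) f
substituted-below (Substituted-1 b c f) zero _ = ≡.refl
substituted-below (Substituted-1 b c f) (suc i) (s≤s ())
substituted-above (Substituted-1 b c f) (suc i) _ = ≡.refl
substituted-base (Substituted-1 b c f) i rewrite +-comm i 1 = ≡.refl

data SubstVar (j : ℕ) (u : Term) (i : ℕ) : Set where
  below : i < j → subst j u (var i) ≡ var i → SubstVar j u i
  at : i ≡ j → subst j u (var i) ≡ shift j 0 u → SubstVar j u i
  above : ∀ i′ → i ≡ suc i′ → j ≤ i′ → subst j u (var i) ≡ var i′ → SubstVar j u i

substVar : ∀ j u i → SubstVar j u i
substVar j u i with <-cmp i j
... | tri< p _ _ = below p (subst-var-< {u = u} p)
... | tri≈ _ ≡.refl _ = at ≡.refl (subst-var-≡ i u)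
substVar j u (suc i) | tri> _ _ (s≤s p) = above i ≡.refl p (subst-var-> {u = u} p)

-- Good ys ds d t: every free variable of t marked in ys (a residual of y) occurs
-- only as the last argument of a residual of D w D y, in which D may have
-- become a variable marked in ds (a residual of D). The depth d counts the
-- binders above t, and Slot constrains the residuals of w.
module Cores (Slot : ℕ → Term → Set)
  (slot-⟶β : ∀ {d w w′} → Slot d w → w ⟶β w′ → Slot d w′)
  (slot-subst : ∀ {d w j u} → Slot (suc d) w → j ≤ d → Slot d (subst j u w))
  (slot-shift : ∀ {d w k c} → c ≤ d → Slot d w → Slot (k + d) (shift k c w)) where

  data Good : (ℕ → Bool) → (ℕ → Bool) → ℕ → Term → Set where
    good-var : ∀ {ys ds d i} → ys i ≡ false → Good ys ds d (var i)
    good-lam : ∀ {ys ds d b} → Good (false ◃ ys) (false ◃ ds) (suc d) b → Good ys ds d (lam b)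
    good-app : ∀ {ys ds d f a} → Good ys ds d f → Good ys ds d a → Good ys ds d (app f a)
    core : ∀ {ys ds d v w} → ys v ≡ true → Slot d w → Good ys ds d w →
      Good ys ds d (app (app (app D w) D) (var v))
    coreᵛ : ∀ {ys ds d e v w} → ds e ≡ true → ys v ≡ true → Slot d w → Good ys ds d w →
      Good ys ds d (app (app (app (var e) w) (var e)) (var v))
    core₁ : ∀ {ys ds d v Q} → ys v ≡ true →
      Good (true ◃ false ◃ ys) (false ◃ true ◃ ds) (suc (suc d)) Q →
      Good ys ds d (app (app (lam (lam Q)) D) (var v))
    core₂ : ∀ {ys ds d v Q} → ys v ≡ true → Good (true ◃ ys) (false ◃ ds) (suc d) Q →
      Good ys ds d (app (lam Q) (var v))

  good-lam⁻ : ∀ {ys ds d b} → Good ys ds d (lam b) → Good (false ◃ ys) (false ◃ ds) (suc d) b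
  good-lam⁻ (good-lam g) = g

  good-D : ∀ {ys ds d} → Good ys ds d D
  good-D = good-lam (good-lam (good-lam (good-app (good-var ≡.refl)
    (good-app (good-app (good-app (good-var ≡.refl) (good-var ≡.refl)) (good-var ≡.refl))
              (good-var ≡.refl)))))

  good-unmarked : ∀ {ys ds d} x → (∀ i → i ∈FV x → ys i ≡ false) → Good ys ds d x
  good-unmarked (var i) unmarked = good-var (unmarked i fv-var)
  good-unmarked (app x y) unmarked =
    good-app (good-unmarked x (λ i f → unmarked i (fv-appˡ f)))
             (good-unmarked y (λ i f → unmarked i (fv-appʳ f)))
  good-unmarked {ys} (lam x) unmarked = good-lam (good-unmarked x unmarked′)
    where
    unmarked′ : ∀ i → i ∈FV x → (false ◃ ys) i ≡ false
    unmarked′ zero _ = ≡.refl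
    unmarked′ (suc i) f = unmarked i (fv-lam f)

  good-foldl-app : ∀ {ys ds d k} (xs : Vec Term k) {X} →
    Good ys ds d X → All (Good ys ds d) xs → Good ys ds d (foldl (λ _ → Term) app X xs)
  good-foldl-app [] g [] = g
  good-foldl-app (x ∷ xs) g (gx ∷ gxs) = good-foldl-app xs (good-app g gx) gxs

  good-shift : ∀ {ys ds d ys′ ds′ d′} k c {B} → Good ys ds d B →
    Shifted k c ys ys′ → Shifted k c ds ds′ → d′ ≡ k + d → c ≤ d →
    Good ys′ ds′ d′ (shift k c B)
  good-shift k c (good-var {i = i} n) sy sd e c≤d rewrite shift-var k c i =
    good-var (≡.trans (Shifted-index sy i) n)
  good-shift k c (good-lam {d = d} g) sy sd e c≤d =
    good-lam (good-shift k (suc c) g (Shifted-◃ false sy) (Shifted-◃ false sd)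
      (≡.trans (cong suc e) (≡.sym (+-suc k d))) (s≤s c≤d))
  good-shift k c (good-app g h) sy sd e c≤d =
    good-app (good-shift k c g sy sd e c≤d) (good-shift k c h sy sd e c≤d)
  good-shift k c (core {v = v} y sl g) sy sd ≡.refl c≤d rewrite shift-var k c v =
    core (≡.trans (Shifted-index sy v) y) (slot-shift c≤d sl) (good-shift k c g sy sd ≡.refl c≤d)
  good-shift k c (coreᵛ {e = e} {v} δ y sl g) sy sd ≡.refl c≤d
    rewrite shift-var k c v | shift-var k c e =
    coreᵛ (≡.trans (Shifted-index sd e) δ) (≡.trans (Shifted-index sy v) y) (slot-shift c≤d sl)
      (good-shift k c g sy sd ≡.refl c≤d)
  good-shift k c (core₁ {d = d} {v} y g) sy sd e c≤d rewrite shift-var k c v =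
    core₁ (≡.trans (Shifted-index sy v) y)
      (good-shift k (suc (suc c)) g (Shifted-◃ true (Shifted-◃ false sy))
        (Shifted-◃ false (Shifted-◃ true sd))
        (≡.trans (cong (λ z → suc (suc z)) e) (≡.sym (≡.trans (+-suc k (suc d)) (cong suc (+-suc k d)))))
        (s≤s (s≤s c≤d)))
  good-shift k c (core₂ {d = d} {v} y g) sy sd e c≤d rewrite shift-var k c v =
    core₂ (≡.trans (Shifted-index sy v) y)
      (good-shift k (suc c) g (Shifted-◃ true sy) (Shifted-◃ false sd)
        (≡.trans (cong suc e) (≡.sym (+-suc k d))) (s≤s c≤d))

  record Substitutable (y? δ? : Bool) (ys₀ ds₀ : ℕ → Bool) (d₀ : ℕ) (u : Term) : Set where
    field
      if-y : y? ≡ true → ∃ λ v → u ≡ var v × ys₀ v ≡ true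
      if-not-y : y? ≡ false → Good ys₀ ds₀ d₀ u
      if-D : δ? ≡ true → u ≡ D

  module _ {j u ys ys′ ys₀ ds ds′ ds₀ d₀}
    (sy : Substituted j ys ys′ ys₀) (sd : Substituted j ds ds′ ds₀)
    (su : Substitutable (ys j) (ds j) ys₀ ds₀ d₀ u) where
    open Substitutable su

    subst-y : ∀ {v} → ys v ≡ true → ∃ λ v′ → subst j u (var v) ≡ var v′ × ys′ v′ ≡ true
    subst-y {v} y with substVar j u v
    ... | below p e = v , e , ≡.trans (≡.sym (substituted-below sy v p)) y
    ... | above i′ ≡.refl p e = i′ , e , ≡.trans (≡.sym (substituted-above sy i′ p)) y
    ... | at ≡.refl e with if-y y
    ...   | v₀ , ≡.refl , y₀ =
      v₀ + j , ≡.trans e (shift-var-≥ {j} z≤n) , ≡.trans (substituted-base sy v₀) y₀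

    subst-D : ∀ {e} → ds e ≡ true →
      subst j u (var e) ≡ D ⊎ ∃ λ e′ → subst j u (var e) ≡ var e′ × ds′ e′ ≡ true
    subst-D {e} δ with substVar j u e
    ... | below p q = inj₂ (e , q , ≡.trans (≡.sym (substituted-below sd e p)) δ)
    ... | above i′ ≡.refl p q = inj₂ (i′ , q , ≡.trans (≡.sym (substituted-above sd i′ p)) δ)
    ... | at ≡.refl q with if-D δ
    ...   | ≡.refl = inj₁ q

    good-subst-var : ∀ {i} → ys i ≡ false → Good ys′ ds′ (j + d₀) (subst j u (var i))
    good-subst-var {i} n with substVar j u i
    ... | below p e rewrite e = good-var (≡.trans (≡.sym (substituted-below sy i p)) n)
    ... | above i′ ≡.refl p e rewrite e = good-var (≡.trans (≡.sym (substituted-above sy i′ p)) n)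
    ... | at ≡.refl e rewrite e =
      good-shift j 0 (if-not-y n)
        (record { shifted-below = λ _ (); shifted-above = λ i _ → substituted-base sy i })
        (record { shifted-below = λ _ (); shifted-above = λ i _ → substituted-base sd i }) ≡.refl z≤n

  core-≡ : ∀ {ys ds d v w x} → x ≡ var v → ys v ≡ true → Slot d w → Good ys ds d w →
    Good ys ds d (app (app (app D w) D) x)
  core-≡ ≡.refl = core

  coreᵛ-≡ : ∀ {ys ds d e v w b x} → b ≡ var e → x ≡ var v → ds e ≡ true → ys v ≡ true →
    Slot d w → Good ys ds d w → Good ys ds d (app (app (app b w) b) x)
  coreᵛ-≡ ≡.refl ≡.refl = coreᵛ

  core₁-≡ : ∀ {ys ds d v Q x} → x ≡ var v → ys v ≡ true →
    Good (true ◃ false ◃ ys) (false ◃ true ◃ ds) (suc (suc d)) Q →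
    Good ys ds d (app (app (lam (lam Q)) D) x)
  core₁-≡ ≡.refl = core₁

  core₂-≡ : ∀ {ys ds d v Q x} → x ≡ var v → ys v ≡ true →
    Good (true ◃ ys) (false ◃ ds) (suc d) Q → Good ys ds d (app (lam Q) x)
  core₂-≡ ≡.refl = core₂

  good-subst : ∀ {ys ds ys′ ds′ ys₀ ds₀ d₀} j u {B} → Good ys ds (suc (j + d₀)) B →
    Substituted j ys ys′ ys₀ → Substituted j ds ds′ ds₀ →
    Substitutable (ys j) (ds j) ys₀ ds₀ d₀ u → Good ys′ ds′ (j + d₀) (subst j u B)
  good-subst j u (good-var n) sy sd su = good-subst-var sy sd su n
  good-subst j u (good-lam g) sy sd su =
    good-lam (good-subst (suc j) u g (Substituted-◃ false sy) (Substituted-◃ false sd) su)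
  good-subst j u (good-app g h) sy sd su =
    good-app (good-subst j u g sy sd su) (good-subst j u h sy sd su)
  good-subst {d₀ = d₀} j u (core y sl g) sy sd su =
    let _ , e , y′ = subst-y sy sd su y
    in core-≡ e y′ (slot-subst sl (m≤m+n j d₀)) (good-subst j u g sy sd su)
  good-subst {d₀ = d₀} j u (coreᵛ δ y sl g) sy sd su with subst-D sy sd su δ
  ... | inj₁ q rewrite q =
    let _ , e , y′ = subst-y sy sd su y
    in core-≡ e y′ (slot-subst sl (m≤m+n j d₀)) (good-subst j u g sy sd su)
  ... | inj₂ (_ , q , δ′) =
    let _ , e , y′ = subst-y sy sd su y
    in coreᵛ-≡ q e δ′ y′ (slot-subst sl (m≤m+n j d₀)) (good-subst j u g sy sd su)
  good-subst j u (core₁ y g) sy sd su =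
    let _ , e , y′ = subst-y sy sd su y
    in core₁-≡ e y′ (good-subst (suc (suc j)) u g (Substituted-◃ true (Substituted-◃ false sy))
                                                 (Substituted-◃ false (Substituted-◃ true sd)) su)
  good-subst j u (core₂ y g) sy sd su =
    let _ , e , y′ = subst-y sy sd su y
    in core₂-≡ e y′ (good-subst (suc j) u g (Substituted-◃ true sy) (Substituted-◃ false sd) su)

  good-⟶β : ∀ {ys ds d t t′} → Good ys ds d t → t ⟶β t′ → Good ys ds d t′
  good-⟶β (good-lam g) (lamξ s) = good-lam (good-⟶β g s)
  good-⟶β {ys} {ds} (good-app (good-lam g) h) beta =
    good-subst 0 _ g (Substituted-0 false ys) (Substituted-0 false ds)
      (record { if-y = λ (); if-not-y = λ _ → h; if-D = λ () })
  good-⟶β (good-app g h) (appL s) = good-app (good-⟶β g s) h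
  good-⟶β (good-app g h) (appR s) = good-app g (good-⟶β h s)
  -- D w ⟶ λb c. w (b w b c), where c is a new residual of y and b one of D.
  good-⟶β {ys} {ds} (core y sl g) (appL (appL beta)) =
    core₁ y (good-app g′ (coreᵛ ≡.refl ≡.refl (slot-shift z≤n sl) g′))
    where g′ = good-shift 2 0 g (Shifted-2 true false ys) (Shifted-2 false true ds) ≡.refl z≤n
  good-⟶β (core y sl g) (appL (appL (appL s))) = ⊥-elim (D-normal s)
  good-⟶β (core y sl g) (appL (appL (appR s))) = core y (slot-⟶β sl s) (good-⟶β g s)
  good-⟶β (core y sl g) (appL (appR s)) = ⊥-elim (D-normal s)
  good-⟶β (coreᵛ δ y sl g) (appL (appL (appR s))) = coreᵛ δ y (slot-⟶β sl s) (good-⟶β g s)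
  good-⟶β {ys} {ds} (core₁ y g) (appL beta) =
    core₂ y (good-subst 1 D g (Substituted-1 true false ys) (Substituted-1 false true ds)
      (record { if-y = λ (); if-not-y = λ _ → good-D; if-D = λ _ → ≡.refl }))
  good-⟶β (core₁ y g) (appL (appL (lamξ (lamξ s)))) = core₁ y (good-⟶β g s)
  good-⟶β (core₁ y g) (appL (appR s)) = ⊥-elim (D-normal s)
  good-⟶β {ys} {ds} (core₂ {v = v} y g) beta =
    good-subst 0 (var v) g (Substituted-0 true ys) (Substituted-0 false ds)
      (record { if-y = λ _ → v , ≡.refl , y; if-not-y = λ (); if-D = λ () })
  good-⟶β (core₂ y g) (appL (lamξ s)) = core₂ y (good-⟶β g s)

  good-↠ : ∀ {ys ds d t t′} → Good ys ds d t → t ↠ t′ → Good ys ds d t′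
  good-↠ = ↠-invariant good-⟶β

-- Measured inside λx, so that x is var d at depth d.
XSlot : ℕ → Term → Set
XSlot d w = w ≡ var d

XSlot-⟶β : ∀ {d w w′} → XSlot d w → w ⟶β w′ → XSlot d w′
XSlot-⟶β ≡.refl ()

XSlot-subst : ∀ {d w j u} → XSlot (suc d) w → j ≤ d → XSlot d (subst j u w)
XSlot-subst {u = u} ≡.refl p = subst-var-> {u = u} p

XSlot-shift : ∀ {d w k c} → c ≤ d → XSlot d w → XSlot (k + d) (shift k c w)
XSlot-shift {d} {k = k} p ≡.refl = ≡.trans (shift-var-≥ p) (cong var (+-comm d k))

-- At depth d the variable y (index t at the top) is var (t + d), and the
-- variables free at the top are those ≥ d.
module _ (t : ℕ) where
  OuterSlot : ℕ → Term → Set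
  OuterSlot d w = ∀ i → i ∈FV w → d ≤ i × i ≢ t + d

  OuterSlot-⟶β : ∀ {d w w′} → OuterSlot d w → w ⟶β w′ → OuterSlot d w′
  OuterSlot-⟶β h s i f = h i (∈FV-⟶β⁻ s f)

  OuterSlot-subst : ∀ {d w j u} → OuterSlot (suc d) w → j ≤ d → OuterSlot d (subst j u w)
  OuterSlot-subst {d} {w} {j} {u} h j≤d i f with ∈FV-subst⁻ j u w f
  ... | inj₁ (i<j , g) = ⊥-elim (<⇒≱ (<-≤-trans i<j j≤d) (≤-trans (n≤1+n d) (proj₁ (h i g))))
  ... | inj₂ (inj₂ (g , _)) = ⊥-elim (1+n≰n (≤-trans (proj₁ (h j g)) j≤d))
  ... | inj₂ (inj₁ (_ , g)) with h (suc i) g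
  ...   | s≤s d≤i , i≢y = d≤i , λ e → i≢y (≡.trans (cong suc e) (≡.sym (+-suc t d)))

  OuterSlot-shift : ∀ {d w k c} → c ≤ d → OuterSlot d w → OuterSlot (k + d) (shift k c w)
  OuterSlot-shift {d} {w} {k} {c} c≤d h i f with ∈FV-shift⁻ k c w f
  ... | inj₁ (i<c , g) = ⊥-elim (<⇒≱ (<-≤-trans i<c c≤d) (proj₁ (h i g)))
  ... | inj₂ (i₀ , _ , ≡.refl , g) with h i₀ g
  ...   | d≤i₀ , i₀≢y =
    ≡.subst (_≤ i₀ + k) (+-comm d k) (+-monoˡ-≤ k d≤i₀) ,
    λ e → i₀≢y (+-cancelʳ-≡ k i₀ (t + d) (≡.trans e (x∙yz≈xz∙y t k d)))

module XCores = Cores XSlot XSlot-⟶β XSlot-subst XSlot-shift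
module OuterCores (t : ℕ) =
  Cores (OuterSlot t) (OuterSlot-⟶β t) (OuterSlot-subst t) (OuterSlot-shift t)

marked-and-unmarked : ∀ {b} → b ≡ true → b ≡ false → ⊥
marked-and-unmarked ≡.refl ()

-- At an occurrence of a marked variable both derivations must use the same kind
-- of residual; the slot is the variable d on one side and avoids it on the other.
good-clash : ∀ {t ys ds d N v} → XCores.Good ys ds d N → OuterCores.Good t ys ds (suc d) N →
  LambdaI N → ys v ≡ true → v ∈FV N → ⊥
good-clash (XCores.good-var n) _ _ y fv-var = marked-and-unmarked y n
good-clash (XCores.good-lam g) (OuterCores.good-lam h) (li-lam _ l) y (fv-lam f) = good-clash g h l y f
good-clash (XCores.good-app g g′) (OuterCores.good-app h h′) (li-app l l′) y (fv-appˡ f) =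
  good-clash g h l y f
good-clash (XCores.good-app g g′) (OuterCores.good-app h h′) (li-app l l′) y (fv-appʳ f) =
  good-clash g′ h′ l′ y f
good-clash (XCores.good-app _ (XCores.good-var n)) (OuterCores.core y _ _) _ _ _ =
  marked-and-unmarked y n
good-clash (XCores.good-app _ (XCores.good-var n)) (OuterCores.coreᵛ _ y _ _) _ _ _ =
  marked-and-unmarked y n
good-clash (XCores.good-app _ (XCores.good-var n)) (OuterCores.core₁ y _) _ _ _ = marked-and-unmarked y n
good-clash (XCores.good-app _ (XCores.good-var n)) (OuterCores.core₂ y _) _ _ _ = marked-and-unmarked y n
good-clash (XCores.core y _ _) (OuterCores.good-app _ (OuterCores.good-var n)) _ _ _ =
  marked-and-unmarked y n
good-clash (XCores.coreᵛ _ y _ _) (OuterCores.good-app _ (OuterCores.good-var n)) _ _ _ =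
  marked-and-unmarked y n
good-clash (XCores.core₁ y _) (OuterCores.good-app _ (OuterCores.good-var n)) _ _ _ =
  marked-and-unmarked y n
good-clash (XCores.core₂ y _) (OuterCores.good-app _ (OuterCores.good-var n)) _ _ _ =
  marked-and-unmarked y n
good-clash {d =
  d} (XCores.core _ ≡.refl _) (OuterCores.core _ slot _) _ _ _ = 1+n≰n (proj₁ (slot d fv-var))
good-clash {d =
  d} (XCores.coreᵛ _ _ ≡.refl _) (OuterCores.coreᵛ _ _ slot _) _ _ _ = 1+n≰n (proj₁ (slot d fv-var))
good-clash (XCores.core₁ _ g) (OuterCores.core₁ _ h) (li-app (li-app (li-lam _ (li-lam f l)) _) _) _ _ =
  good-clash g h l ≡.refl f
good-clash (XCores.core₂ _ g) (OuterCores.core₂ _ h) (li-app (li-lam f l) _) _ _ =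
  good-clash g h l ≡.refl f

Y-body : ℕ → Term
Y-body t = app (app (app D (var 0)) D) (var (suc t))

Y : ℕ → Term
Y t = lam (Y-body t)

Y-wfpc : ∀ t → IsWfpcSeq (λ _ → Y t)
Y-wfpc t _ =
  trans (↠⇒=β (≡.subst (app (weaken (Y t)) (var 0) ↠_) unfolded steps)) (sym (step (appR beta)))
  where
  steps : app (weaken (Y t)) (var 0) ↠ app (var 0) (app (app (app D (var 0)) D) (var (t + 1 + 0)))
  steps = beta ◅ appL (appL beta) ◅ appL beta ◅ beta ◅ ε
  unfolded : app (var 0) (app (app (app D (var 0)) D) (var (t + 1 + 0)))
           ≡ app (var 0) (app (app (app D (var 0)) D) (var (t + 1)))
  unfolded = cong (λ i → app (var 0) (app (app (app D (var 0)) D) (var i))) (+-identityʳ (t + 1))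

only : ℕ → ℕ → Bool
only t i = i ≡ᵇ t

none : ℕ → Bool
none _ = false

Y-body-good : ∀ t → XCores.Good (false ◃ only t) (false ◃ none) 0 (Y-body t)
Y-body-good t = XCores.core (≡ᵇ-refl t) ≡.refl (XCores.good-var ≡.refl)

Y-body-LambdaI : ∀ t → LambdaI (Y-body t)
Y-body-LambdaI t = li-app (li-app (li-app LambdaI-D li-var) LambdaI-D) li-var

LambdaI∧∈FV-↠ : ∀ {i t t′} → LambdaI t × i ∈FV t → t ↠ t′ → LambdaI t′ × i ∈FV t′
LambdaI∧∈FV-↠ = ↠-invariant (λ (l , f) s → LambdaI-⟶β l s , LambdaI-⟶β-∈FV l s f)

fresh : ∀ {k} → Vec Term k → ℕ
fresh [] = 0
fresh (x ∷ xs) = fvBound x ⊔ fresh xs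

fresh-bounds : ∀ {k t} (xs : Vec Term k) → fresh xs ≤ t → All (λ x → fvBound x ≤ t) xs
fresh-bounds [] _ = []
fresh-bounds (x ∷ xs) le =
  m⊔n≤o⇒m≤o (fvBound x) (fresh xs) le ∷ fresh-bounds xs (m⊔n≤o⇒n≤o (fvBound x) (fresh xs) le)

fvBound≤⇒unmarked : ∀ {t x} → fvBound x ≤ t → ∀ i → i ∈FV x → only t i ≡ false
fvBound≤⇒unmarked le i f = ≢⇒≡ᵇ≡false (<⇒≢ (<-≤-trans (∈FV⇒<fvBound f) le))

foldl-appˡ : ∀ {k} (xs : Vec Term k) {X X′} → X ⟶β X′ →
  foldl (λ _ → Term) app X xs ⟶β foldl (λ _ → Term) app X′ xs
foldl-appˡ [] s = s
foldl-appˡ (x ∷ xs) s = foldl-appˡ xs (appL s)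

Y-apps : ∀ {k} t M (Ms : Vec Term k) →
  apps (Y t) (M ∷ Ms) ↠ foldl (λ _ → Term) app (app (app (app D M) D) (var t)) Ms
Y-apps t M Ms =
  ≡.subst (λ w → apps (Y t) (M ∷ Ms) ↠ foldl (λ _ → Term) app (app (app (app D w) D) (var t)) Ms)
    (shift-zero 0 M) (foldl-appˡ Ms beta ◅ ε)

Y-apps-good : ∀ {k} t M (Ms : Vec Term k) → fresh (M ∷ Ms) ≤ t →
  OuterCores.Good t (only t) none 0 (foldl (λ _ → Term) app (app (app (app D M) D) (var t)) Ms)
Y-apps-good t M Ms le =
  OuterCores.good-foldl-app t Ms
    (OuterCores.core (≡ᵇ-refl t) slot (OuterCores.good-unmarked t M (fvBound≤⇒unmarked M≤t)))
    (All.map (λ le → OuterCores.good-unmarked t _ (fvBound≤⇒unmarked le)) (fresh-bounds Ms Ms≤t))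
  where
  M≤t = m⊔n≤o⇒m≤o (fvBound M) (fresh Ms) le
  Ms≤t = m⊔n≤o⇒n≤o (fvBound M) (fresh Ms) le
  slot : OuterSlot t 0 M
  slot i f = z≤n , λ i≡t → <⇒≢ (<-≤-trans (∈FV⇒<fvBound f) M≤t) (≡.trans i≡t (+-identityʳ t))

Y-reducts-avoid : ∀ t {s N} → OuterCores.Good t (only t) none 0 s → s ↠ N → ¬ (Y t ↠ N)
Y-reducts-avoid t good s↠N Y↠N with lam-↠⁻ Y↠N
... | N′ , ≡.refl , body↠N′ =
  good-clash (XCores.good-↠ (Y-body-good t) body↠N′)
    (OuterCores.good-lam⁻ t (OuterCores.good-↠ t good s↠N))
    (proj₁ λI∧y∈N′) (≡ᵇ-refl t) (proj₂ λI∧y∈N′)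
  where
  λI∧y∈N′ = LambdaI∧∈FV-↠ (Y-body-LambdaI t , fv-appʳ fv-var) body↠N′

Y-apps≉Y : ∀ {k} M (Ms : Vec Term k) → ¬ (apps (Y (fresh (M ∷ Ms))) (M ∷ Ms) =β Y (fresh (M ∷ Ms)))
Y-apps≉Y M Ms eq =
  let t = fresh (M ∷ Ms)
      _ , s↠N , Y↠N = church-rosser (trans (sym (↠⇒=β (Y-apps t M Ms))) eq)
  in Y-reducts-avoid t (Y-apps-good t M Ms ≤-refl) s↠N Y↠N

proposition3p7 : (m : ℕ) → 0 < m →
    ¬ (Σ ℕ λ n → Σ (Vec Term (suc n)) λ M →
        (Z : ℕ → Term) → IsWfpcSeq Z → apps (Z 0) M =β Z m)
proposition3p7 m _ (n , M ∷ Ms , hyp) = Y-apps≉Y M Ms (hyp (λ _ → Y (fresh (M ∷ Ms))) (Y-wfpc _))
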